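{- For every $f\in\mathcal E(X)$ there exists a one-free expression $[f]$ such that $[f]\leqq f$ and, for every one-free expression $e$ with $e\lesssim f$, we have $e\lesssim [f]$.
   Context: Fix a set $X$ of variables. Expressions $\mathcal E(X)$ are generated by $e,f::= x \mid 0\mid 1\mid e+f\mid e\cdot f\mid e\cap f\mid e^+\mid \overline{e}$; one-free expressions are those not containing $1$. Semantics: for an alphabet $\Sigma$ and $\sigma:X\to\mathcal P(\Sigma^\star)$, $[\![x]\!]_\sigma=\sigma(x)$, $[\![0]\!]_\sigma=\emptyset$, $[\![1]\!]_\sigma=\{\epsilon\}$, $+$ union, $\cap$ intersection, $\cdot$ concatenation, $e^+$ is $\bigcup_{n\ge1}[\![e]\!]_\sigma^n$, $\overline e$ the set of reversed words. $e\lesssim f$ means $[\![e]\!]_\sigma\subseteq[\![f]\!]_\sigma$ for all $\Sigma,\sigma$. $e\leqq f$ means $e+f\equiv f$, where $\equiv$ is the smallest congruence on $\mathcal E(X)$ containing, for all $e,f,g$: $e+f=f+e$; $e+(f+g)=(e+f)+g$; $e+0=e$; $e\cap f=f\cap e$; $e\cap e=e$; $e\cap(f\cap g)=(e\cap f)\cap g$; $(e+f)\cap g=e\cap g+f\cap g$; $(e\cap f)+e=e$; $e\cdot(f\cdot g)=(e\cdot f)\cdot g$; $e\cdot 0=0=0\cdot e$; $(e+f)\cdot g=e\cdot g+f\cdot g$; $e\cdot(f+g)=e\cdot f+e\cdot g$; $e^+=e+e\cdot e^+$; $e^+=e+e^+\cdot e$; $\overline{\overline e}=e$; $\overline{e+f}=\overline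 e+\overline f$; $\overline{e\cdot f}=\overline f\cdot\overline e$; $\overline{e\cap f}=\overline e\cap\overline f$; $\overline{e^+}=\overline e^{\,+}$; $1\cdot e=e=e\cdot 1$; $1\cap(e\cdot f)=1\cap(e\cap f)$; $1\cap\overline e=1\cap e$; $(1\cap e)\cdot f=f\cdot(1\cap e)$; $((1\cap e)\cdot f)\cap g=(1\cap e)\cdot(f\cap g)$; $(g+(1\cap e)\cdot f)^+=g^++(1\cap e)\cdot(g+f)^+$; and closed under: if $e\cdot f+f\equiv f$ then $e^+\cdot f+f\equiv f$; if $f\cdot e+f\equiv f$ then $f\cdot e^++f\equiv f$. -}

module Defs where

open import Data.List using (List; []; _∷_; _++_; reverse)
open import Data.Product using (Σ; ∃; _×_; _,_)
open import Relation.Binary.PropositionalEquality using (_≡_)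
open import Data.Unit using (⊤)
open import Data.Empty using (⊥)

infixl 6 _⊕_
infixl 7 _⊙_
infixl 8 _⊓_
infix 9 _⁺
infix 4 _≃_ _≦_ _≲_

data Expr (X : Set) : Set where
  var  : X → Expr X
  𝟘    : Expr X
  𝟙    : Expr X
  _⊕_  : Expr X → Expr X → Expr X
  _⊙_  : Expr X → Expr X → Expr X
  _⊓_  : Expr X → Expr X → Expr X
  _⁺   : Expr X → Expr X
  conv : Expr X → Expr X

OneFree : {X : Set} → Expr X → Set
OneFree (var x)  = ⊤
OneFree 𝟘        = ⊤
OneFree 𝟙        = ⊥
OneFree (e ⊕ f)  = OneFree e × OneFree f
OneFree (e ⊙ f)  = OneFree e × OneFree f
OneFree (e ⊓ f)  = OneFree e × OneFree f
OneFree (e ⁺)    = OneFree e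
OneFree (conv e) = OneFree e

Lang : Set → Set₁
Lang A = List A → Set

data Plus {A : Set} (L : Lang A) : Lang A where
  one  : ∀ {w} → L w → Plus L w
  more : ∀ {u v} → L u → Plus L v → Plus L (u ++ v)

⟦_⟧ : {X A : Set} → Expr X → (X → Lang A) → Lang A
⟦ var x ⟧  σ w = σ x w
⟦ 𝟘 ⟧      σ w = ⊥
⟦ 𝟙 ⟧      σ w = w ≡ []
⟦ e ⊕ f ⟧  σ w = Data.Sum._⊎_ (⟦ e ⟧ σ w) (⟦ f ⟧ σ w)
  where import Data.Sum
⟦ e ⊙ f ⟧  σ w = Σ (List _) λ u → Σ (List _) λ v → (w ≡ u ++ v) × ⟦ e ⟧ σ u × ⟦ f ⟧ σ v
⟦ e ⊓ f ⟧  σ w = ⟦ e ⟧ σ w × ⟦ f ⟧ σ w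
⟦ e ⁺ ⟧    σ w = Plus (⟦ e ⟧ σ) w
⟦ conv e ⟧ σ w = ⟦ e ⟧ σ (reverse w)

_≲_ : {X : Set} → Expr X → Expr X → Set₁
_≲_ {X} e f = (A : Set) (σ : X → Lang A) (w : List A) → ⟦ e ⟧ σ w → ⟦ f ⟧ σ w

data _≃_ {X : Set} : Expr X → Expr X → Set where
  ≃-refl  : ∀ {e} → e ≃ e
  ≃-sym   : ∀ {e f} → e ≃ f → f ≃ e
  ≃-trans : ∀ {e f g} → e ≃ f → f ≃ g → e ≃ g
  ⊕-cong  : ∀ {e e' f f'} → e ≃ e' → f ≃ f' → e ⊕ f ≃ e' ⊕ f'
  ⊙-cong  : ∀ {e e' f f'} → e ≃ e' → f ≃ f' → e ⊙ f ≃ e' ⊙ f'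
  ⊓-cong  : ∀ {e e' f f'} → e ≃ e' → f ≃ f' → e ⊓ f ≃ e' ⊓ f'
  ⁺-cong  : ∀ {e e'} → e ≃ e' → e ⁺ ≃ e' ⁺
  conv-cong : ∀ {e e'} → e ≃ e' → conv e ≃ conv e'
  ⊕-comm  : ∀ e f → e ⊕ f ≃ f ⊕ e
  ⊕-assoc : ∀ e f g → e ⊕ (f ⊕ g) ≃ (e ⊕ f) ⊕ g
  ⊕-zero  : ∀ e → e ⊕ 𝟘 ≃ e
  ⊓-comm  : ∀ e f → e ⊓ f ≃ f ⊓ e
  ⊓-idem  : ∀ e → e ⊓ e ≃ e
  ⊓-assoc : ∀ e f g → e ⊓ (f ⊓ g) ≃ (e ⊓ f) ⊓ g
  ⊓-distr : ∀ e f g → (e ⊕ f) ⊓ g ≃ e ⊓ g ⊕ f ⊓ g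
  absorb  : ∀ e f → (e ⊓ f) ⊕ e ≃ e
  ⊙-assoc : ∀ e f g → e ⊙ (f ⊙ g) ≃ (e ⊙ f) ⊙ g
  ⊙-zeroʳ : ∀ e → e ⊙ 𝟘 ≃ 𝟘
  ⊙-zeroˡ : ∀ e → 𝟘 ⊙ e ≃ 𝟘
  ⊙-distrʳ : ∀ e f g → (e ⊕ f) ⊙ g ≃ e ⊙ g ⊕ f ⊙ g
  ⊙-distrˡ : ∀ e f g → e ⊙ (f ⊕ g) ≃ e ⊙ f ⊕ e ⊙ g
  ⁺-unfoldˡ : ∀ e → e ⁺ ≃ e ⊕ e ⊙ e ⁺
  ⁺-unfoldʳ : ∀ e → e ⁺ ≃ e ⊕ e ⁺ ⊙ e
  conv-conv : ∀ e → conv (conv e) ≃ e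
  conv-⊕  : ∀ e f → conv (e ⊕ f) ≃ conv e ⊕ conv f
  conv-⊙  : ∀ e f → conv (e ⊙ f) ≃ conv f ⊙ conv e
  conv-⊓  : ∀ e f → conv (e ⊓ f) ≃ conv e ⊓ conv f
  conv-⁺  : ∀ e → conv (e ⁺) ≃ (conv e) ⁺
  ⊙-unitˡ : ∀ e → 𝟙 ⊙ e ≃ e
  ⊙-unitʳ : ∀ e → e ⊙ 𝟙 ≃ e
  𝟙-⊓-⊙   : ∀ e f → 𝟙 ⊓ (e ⊙ f) ≃ 𝟙 ⊓ (e ⊓ f)
  𝟙-⊓-conv : ∀ e → 𝟙 ⊓ conv e ≃ 𝟙 ⊓ e
  𝟙-⊓-comm : ∀ e f → (𝟙 ⊓ e) ⊙ f ≃ f ⊙ (𝟙 ⊓ e)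
  𝟙-⊓-⊓   : ∀ e f g → ((𝟙 ⊓ e) ⊙ f) ⊓ g ≃ (𝟙 ⊓ e) ⊙ (f ⊓ g)
  𝟙-⊓-⁺   : ∀ e f g → (g ⊕ (𝟙 ⊓ e) ⊙ f) ⁺ ≃ g ⁺ ⊕ (𝟙 ⊓ e) ⊙ (g ⊕ f) ⁺
  ind-l   : ∀ {e f} → e ⊙ f ⊕ f ≃ f → e ⁺ ⊙ f ⊕ f ≃ f
  ind-r   : ∀ {e f} → f ⊙ e ⊕ f ≃ f → f ⊙ e ⁺ ⊕ f ≃ f

_≦_ : {X : Set} → Expr X → Expr X → Set
e ≦ f = e ⊕ f ≃ f

-- [f] drops every 1 from f; a product e · f moreover keeps the summand [f] (resp. [e])
-- when e (resp. f) syntactically contains the empty word, so that [f] ≦ f is derivable.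
--
-- For maximality, let e be one-free with e ≲ f and let w ∈ ⟦e⟧σ. Over the alphabet
-- Maybe A, pad w with runs of blanks (nothing) of length at least gap e between and
-- around its letters, and interpret each variable x by the nonempty words whose letters
-- form a word of σ x. A one-free e still accepts the padded word: every subterm can be
-- handed a nonempty piece of it. Hence f accepts it, and a nonempty word accepted by f
-- under this interpretation is accepted, blanks erased, by [f] under σ.

module Submission where

open import Defs
open import Data.Bool using (Bool; true; false; _∨_; _∧_; T; if_then_else_)
open import Data.Bool.Properties using (T-∨; T-∧)
open import Data.Empty using (⊥-elim)
open import Data.List using (List; []; _∷_; _++_; reverse; replicate; catMaybes; _∷ʳ_)
open import Data.List.Properties
  using ( ++-assoc; ++-identityʳ; ++-conicalˡ; ++-conicalʳ
        ; reverse-++; unfold-reverse; reverse-injective; catMaybes-++ )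
open import Data.Maybe using (Maybe; just; nothing)
open import Data.Nat using (ℕ; zero; suc; _+_; _≤_; s≤s)
open import Data.Nat.Properties
  using (≤-refl; ≤-trans; m≤m+n; m≤n+m; n≤1+n; +-cancelˡ-≤; m+n≤o⇒m≤o; m≤n⇒∃[o]m+o≡n)
open import Data.Product using (Σ; _×_; _,_)
open import Data.Sum using (_⊎_; inj₁; inj₂)
open import Data.Unit using (tt)
open import Function.Bundles using (module Equivalence)
open import Relation.Binary.Bundles using (Setoid)
open import Relation.Binary.PropositionalEquality
  using (_≡_; _≢_; refl; sym; trans; cong; cong₂; subst; subst₂; module ≡-Reasoning)

module _ {X : Set} where

  ≃-setoid : Setoid _ _
  ≃-setoid = record
    { Carrier = Expr X
    ; _≈_ = _≃_
    ; isEquivalence = record { refl = ≃-refl ; sym = ≃-sym ; trans = ≃-trans }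
    }

  open import Relation.Binary.Reasoning.Setoid ≃-setoid

  ≦-refl : {e : Expr X} → e ≦ e
  ≦-refl {e} = begin
    e ⊕ e        ≈⟨ ⊕-cong (≃-sym (⊓-idem e)) ≃-refl ⟩
    e ⊓ e ⊕ e    ≈⟨ absorb e e ⟩
    e            ∎

  ≃⇒≦ : {e f : Expr X} → e ≃ f → e ≦ f
  ≃⇒≦ e≃f = ≃-trans (⊕-cong e≃f ≃-refl) ≦-refl

  ≦-trans : {a b c : Expr X} → a ≦ b → b ≦ c → a ≦ c
  ≦-trans {a} {b} {c} a≦b b≦c = begin
    a ⊕ c          ≈⟨ ⊕-cong ≃-refl (≃-sym b≦c) ⟩
    a ⊕ (b ⊕ c)    ≈⟨ ⊕-assoc a b c ⟩
    (a ⊕ b) ⊕ c    ≈⟨ ⊕-cong a≦b ≃-refl ⟩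
    b ⊕ c          ≈⟨ b≦c ⟩
    c              ∎

  𝟘≦ : {e : Expr X} → 𝟘 ≦ e
  𝟘≦ {e} = ≃-trans (⊕-comm 𝟘 e) (⊕-zero e)

  ≦-⊕ˡ : {a b : Expr X} → a ≦ a ⊕ b
  ≦-⊕ˡ {a} {b} = ≃-trans (⊕-assoc a a b) (⊕-cong ≦-refl ≃-refl)

  ≦-⊕ʳ : {a b : Expr X} → b ≦ a ⊕ b
  ≦-⊕ʳ {a} {b} = ≦-trans ≦-⊕ˡ (≃⇒≦ (⊕-comm b a))

  ⊕-lub : {a b c : Expr X} → a ≦ c → b ≦ c → a ⊕ b ≦ c
  ⊕-lub {a} {b} {c} a≦c b≦c = ≃-trans (≃-sym (⊕-assoc a b c)) (≃-trans (⊕-cong ≃-refl b≦c) a≦c)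

  ⊕-mono : {a b c d : Expr X} → a ≦ b → c ≦ d → a ⊕ c ≦ b ⊕ d
  ⊕-mono a≦b c≦d = ⊕-lub (≦-trans a≦b ≦-⊕ˡ) (≦-trans c≦d ≦-⊕ʳ)

  ⊙-monoˡ : {a b c : Expr X} → a ≦ b → a ⊙ c ≦ b ⊙ c
  ⊙-monoˡ {a} {b} {c} a≦b = ≃-trans (≃-sym (⊙-distrʳ a b c)) (⊙-cong a≦b ≃-refl)

  ⊙-monoʳ : {a b c : Expr X} → a ≦ b → c ⊙ a ≦ c ⊙ b
  ⊙-monoʳ {a} {b} {c} a≦b = ≃-trans (≃-sym (⊙-distrˡ c a b)) (⊙-cong ≃-refl a≦b)

  ⊙-mono : {a b c d : Expr X} → a ≦ b → c ≦ d → a ⊙ c ≦ b ⊙ d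
  ⊙-mono a≦b c≦d = ≦-trans (⊙-monoˡ a≦b) (⊙-monoʳ c≦d)

  ⊓-monoˡ : {a b c : Expr X} → a ≦ b → a ⊓ c ≦ b ⊓ c
  ⊓-monoˡ {a} {b} {c} a≦b = ≃-trans (≃-sym (⊓-distr a b c)) (⊓-cong a≦b ≃-refl)

  ⊓-mono : {a b c d : Expr X} → a ≦ b → c ≦ d → a ⊓ c ≦ b ⊓ d
  ⊓-mono {a} {b} {c} {d} a≦b c≦d =
    ≦-trans (⊓-monoˡ a≦b)
      (≦-trans (≃⇒≦ (⊓-comm b c)) (≦-trans (⊓-monoˡ c≦d) (≃⇒≦ (⊓-comm d b))))

  conv-mono : {a b : Expr X} → a ≦ b → conv a ≦ conv b
  conv-mono {a} {b} a≦b = ≃-trans (≃-sym (conv-⊕ a b)) (conv-cong a≦b)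

  ≦-⁺ : {e : Expr X} → e ≦ e ⁺
  ≦-⁺ {e} = ≦-trans ≦-⊕ˡ (≃⇒≦ (≃-sym (⁺-unfoldˡ e)))

  ⊙⁺≦⁺ : {e : Expr X} → e ⊙ e ⁺ ≦ e ⁺
  ⊙⁺≦⁺ {e} = ≦-trans ≦-⊕ʳ (≃⇒≦ (≃-sym (⁺-unfoldˡ e)))

  ⁺-mono : {a b : Expr X} → a ≦ b → a ⁺ ≦ b ⁺
  ⁺-mono {a} {b} a≦b = ≦-trans (≃⇒≦ (⁺-unfoldʳ a)) (⊕-lub (≦-trans a≦b ≦-⁺) a⁺⊙a≦b⁺)
    where
    a⁺⊙b⁺≦b⁺ : a ⁺ ⊙ b ⁺ ≦ b ⁺
    a⁺⊙b⁺≦b⁺ = ind-l (≦-trans (⊙-monoˡ a≦b) ⊙⁺≦⁺)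

    a⁺⊙a≦b⁺ : a ⁺ ⊙ a ≦ b ⁺
    a⁺⊙a≦b⁺ = ≦-trans (⊙-monoʳ (≦-trans a≦b ≦-⁺)) a⁺⊙b⁺≦b⁺

  conv-𝟙 : conv 𝟙 ≃ 𝟙
  conv-𝟙 = begin
    conv 𝟙                   ≈⟨ ≃-sym (⊙-unitʳ (conv 𝟙)) ⟩
    conv 𝟙 ⊙ 𝟙               ≈⟨ ⊙-cong ≃-refl (≃-sym (conv-conv 𝟙)) ⟩
    conv 𝟙 ⊙ conv (conv 𝟙)   ≈⟨ ≃-sym (conv-⊙ (conv 𝟙) 𝟙) ⟩
    conv (conv 𝟙 ⊙ 𝟙)        ≈⟨ conv-cong (⊙-unitʳ (conv 𝟙)) ⟩
    conv (conv 𝟙)            ≈⟨ conv-conv 𝟙 ⟩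
    𝟙                        ∎

  nullable : Expr X → Bool
  nullable (var x)  = false
  nullable 𝟘        = false
  nullable 𝟙        = true
  nullable (e ⊕ f)  = nullable e ∨ nullable f
  nullable (e ⊙ f)  = nullable e ∧ nullable f
  nullable (e ⊓ f)  = nullable e ∧ nullable f
  nullable (e ⁺)    = nullable e
  nullable (conv e) = nullable e

  nullable⇒𝟙≦ : (e : Expr X) → T (nullable e) → 𝟙 ≦ e
  nullable⇒𝟙≦ 𝟙 _ = ≦-refl
  nullable⇒𝟙≦ (e ⊕ f) ν with Equivalence.to T-∨ ν
  ... | inj₁ νe = ≦-trans (nullable⇒𝟙≦ e νe) ≦-⊕ˡ
  ... | inj₂ νf = ≦-trans (nullable⇒𝟙≦ f νf) ≦-⊕ʳ
  nullable⇒𝟙≦ (e ⊙ f) ν with Equivalence.to T-∧ ν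
  ... | νe , νf =
    ≦-trans (≃⇒≦ (≃-sym (⊙-unitˡ 𝟙))) (⊙-mono (nullable⇒𝟙≦ e νe) (nullable⇒𝟙≦ f νf))
  nullable⇒𝟙≦ (e ⊓ f) ν with Equivalence.to T-∧ ν
  ... | νe , νf =
    ≦-trans (≃⇒≦ (≃-sym (⊓-idem 𝟙))) (⊓-mono (nullable⇒𝟙≦ e νe) (nullable⇒𝟙≦ f νf))
  nullable⇒𝟙≦ (e ⁺) ν = ≦-trans (nullable⇒𝟙≦ e ν) ≦-⁺
  nullable⇒𝟙≦ (conv e) ν = ≦-trans (≃⇒≦ (≃-sym conv-𝟙)) (conv-mono (nullable⇒𝟙≦ e ν))

  infix 9 _when_

  _when_ : Expr X → Bool → Expr X
  g when b = if b then g else 𝟘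

  when-OneFree : {g : Expr X} (b : Bool) → OneFree g → OneFree (g when b)
  when-OneFree true  o = o
  when-OneFree false _ = tt

  when-≦ : {g h : Expr X} (b : Bool) → (T b → g ≦ h) → g when b ≦ h
  when-≦ true  g≦h = g≦h tt
  when-≦ false _   = 𝟘≦

  oneFreePart : Expr X → Expr X
  oneFreePart (var x)  = var x
  oneFreePart 𝟘        = 𝟘
  oneFreePart 𝟙        = 𝟘
  oneFreePart (e ⊕ f)  = oneFreePart e ⊕ oneFreePart f
  oneFreePart (e ⊙ f)  =
    oneFreePart e ⊙ oneFreePart f ⊕ (oneFreePart f when nullable e) ⊕ (oneFreePart e when nullable f)
  oneFreePart (e ⊓ f)  = oneFreePart e ⊓ oneFreePart f
  oneFreePart (e ⁺)    = oneFreePart e ⁺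
  oneFreePart (conv e) = conv (oneFreePart e)

  oneFreePart-OneFree : (e : Expr X) → OneFree (oneFreePart e)
  oneFreePart-OneFree (var x)  = tt
  oneFreePart-OneFree 𝟘        = tt
  oneFreePart-OneFree 𝟙        = tt
  oneFreePart-OneFree (e ⊕ f)  = oneFreePart-OneFree e , oneFreePart-OneFree f
  oneFreePart-OneFree (e ⊙ f)  =
    ((oneFreePart-OneFree e , oneFreePart-OneFree f) , when-OneFree (nullable e) (oneFreePart-OneFree f))
    , when-OneFree (nullable f) (oneFreePart-OneFree e)
  oneFreePart-OneFree (e ⊓ f)  = oneFreePart-OneFree e , oneFreePart-OneFree f
  oneFreePart-OneFree (e ⁺)    = oneFreePart-OneFree e
  oneFreePart-OneFree (conv e) = oneFreePart-OneFree e

  oneFreePart-≦ : (e : Expr X) → oneFreePart e ≦ e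
  oneFreePart-≦ (var x)  = ≦-refl
  oneFreePart-≦ 𝟘        = ≦-refl
  oneFreePart-≦ 𝟙        = 𝟘≦
  oneFreePart-≦ (e ⊕ f)  = ⊕-mono (oneFreePart-≦ e) (oneFreePart-≦ f)
  oneFreePart-≦ (e ⊙ f)  =
    ⊕-lub (⊕-lub (⊙-mono (oneFreePart-≦ e) (oneFreePart-≦ f)) dropˡ) dropʳ
    where
    dropˡ : oneFreePart f when nullable e ≦ e ⊙ f
    dropˡ = when-≦ (nullable e) λ νe →
      ≦-trans (oneFreePart-≦ f)
        (≦-trans (≃⇒≦ (≃-sym (⊙-unitˡ f))) (⊙-monoˡ (nullable⇒𝟙≦ e νe)))

    dropʳ : oneFreePart e when nullable f ≦ e ⊙ f
    dropʳ = when-≦ (nullable f) λ νf →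
      ≦-trans (oneFreePart-≦ e)
        (≦-trans (≃⇒≦ (≃-sym (⊙-unitʳ e))) (⊙-monoʳ (nullable⇒𝟙≦ f νf)))
  oneFreePart-≦ (e ⊓ f)  = ⊓-mono (oneFreePart-≦ e) (oneFreePart-≦ f)
  oneFreePart-≦ (e ⁺)    = ⁺-mono (oneFreePart-≦ e)
  oneFreePart-≦ (conv e) = conv-mono (oneFreePart-≦ e)

  gap : Expr X → ℕ
  gap (var x)  = 1
  gap 𝟘        = 1
  gap 𝟙        = 1
  gap (e ⊕ f)  = gap e + gap f
  gap (e ⊙ f)  = gap e + gap f
  gap (e ⊓ f)  = gap e + gap f
  gap (e ⁺)    = gap e + gap e
  gap (conv e) = gap e

module _ {A : Set} where

  data NonEmptyPlus (L : Lang A) : Lang A where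
    one  : ∀ {a w} → L (a ∷ w) → NonEmptyPlus L (a ∷ w)
    more : ∀ {a v₁ v₂} → L (a ∷ v₁) → NonEmptyPlus L v₂ → NonEmptyPlus L (a ∷ v₁ ++ v₂)

  Plus-nonEmpty : {L : Lang A} {w : List A} → Plus L w → (w ≡ [] × L []) ⊎ NonEmptyPlus L w
  Plus-nonEmpty {L} (one {w} l) = single w l
    where
    single : ∀ w → L w → (w ≡ [] × L []) ⊎ NonEmptyPlus L w
    single []      l = inj₁ (refl , l)
    single (_ ∷ _) l = inj₂ (one l)
  Plus-nonEmpty (more {[]} _ p) = Plus-nonEmpty p
  Plus-nonEmpty {L} (more {a ∷ u} l p) with Plus-nonEmpty p
  ... | inj₁ (refl , _) = inj₂ (subst (NonEmptyPlus L) (sym (++-identityʳ (a ∷ u))) (one l))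
  ... | inj₂ q          = inj₂ (more l q)

  pad : ℕ → List (Maybe A)
  pad k = replicate k nothing

  pad-+ : ∀ m k → pad (m + k) ≡ pad m ++ pad k
  pad-+ zero    k = refl
  pad-+ (suc m) k = cong (nothing ∷_) (pad-+ m k)

  reverse-pad : ∀ k → reverse (pad k) ≡ pad k
  reverse-pad zero    = refl
  reverse-pad (suc k) = begin
    reverse (nothing ∷ pad k)  ≡⟨ unfold-reverse nothing (pad k) ⟩
    reverse (pad k) ∷ʳ nothing ≡⟨ cong (_∷ʳ nothing) (reverse-pad k) ⟩
    pad k ∷ʳ nothing           ≡⟨ pad-∷ʳ k ⟩
    nothing ∷ pad k            ∎
    where
    open ≡-Reasoning
    pad-∷ʳ : ∀ k → pad k ∷ʳ nothing ≡ nothing ∷ pad k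
    pad-∷ʳ zero    = refl
    pad-∷ʳ (suc k) = cong (nothing ∷_) (pad-∷ʳ k)

  catMaybes-pad : ∀ k → catMaybes (pad k) ≡ []
  catMaybes-pad zero    = refl
  catMaybes-pad (suc k) = catMaybes-pad k

  catMaybes-reverse : (u : List (Maybe A)) → catMaybes (reverse u) ≡ reverse (catMaybes u)
  catMaybes-reverse []      = refl
  catMaybes-reverse (x ∷ u) = begin
    catMaybes (reverse (x ∷ u))              ≡⟨ cong catMaybes (unfold-reverse x u) ⟩
    catMaybes (reverse u ++ x ∷ [])          ≡⟨ catMaybes-++ (reverse u) (x ∷ []) ⟩
    catMaybes (reverse u) ++ catMaybes (x ∷ []) ≡⟨ cong (_++ _) (catMaybes-reverse u) ⟩
    reverse (catMaybes u) ++ catMaybes (x ∷ []) ≡⟨ snoc x ⟩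
    reverse (catMaybes (x ∷ u))              ∎
    where
    open ≡-Reasoning
    snoc : ∀ x → reverse (catMaybes u) ++ catMaybes (x ∷ []) ≡ reverse (catMaybes (x ∷ u))
    snoc nothing  = ++-identityʳ _
    snoc (just a) = sym (unfold-reverse a (catMaybes u))

  data Padding (f n : ℕ) : List (Maybe A) → List A → Set where
    pad-[] : ∀ {k} → f ≤ k → Padding f n (pad k) []
    pad-∷  : ∀ {k a u w} → f ≤ k → Padding n n u w → Padding f n (pad k ++ just a ∷ u) (a ∷ w)

  Padding-catMaybes : ∀ {f n u w} → Padding f n u w → catMaybes u ≡ w
  Padding-catMaybes (pad-[] {k} _) = catMaybes-pad k
  Padding-catMaybes (pad-∷ {k} {a} {u} _ p) =
    trans (catMaybes-++ (pad k) (just a ∷ u))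
      (cong₂ _++_ (catMaybes-pad k) (cong (a ∷_) (Padding-catMaybes p)))

  Padding-nonempty : ∀ {f n u w} → Padding (suc f) n u w → u ≢ []
  Padding-nonempty (pad-[] (s≤s _)) ()
  Padding-nonempty (pad-∷ {k} _ _) u≡[] with ++-conicalʳ (pad k) _ u≡[]
  ... | ()

  Padding-mono : ∀ {f f′ n n′ u w} → f′ ≤ f → n′ ≤ n → Padding f n u w → Padding f′ n′ u w
  Padding-mono f′≤f n′≤n (pad-[] f≤k)  = pad-[] (≤-trans f′≤f f≤k)
  Padding-mono f′≤f n′≤n (pad-∷ f≤k p) = pad-∷ (≤-trans f′≤f f≤k) (Padding-mono n′≤n n′≤n p)

  uniformPadding : ∀ n (w : List A) → Σ (List (Maybe A)) λ u → Padding n n u w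
  uniformPadding n []      = pad n , pad-[] ≤-refl
  uniformPadding n (a ∷ w) with uniformPadding n w
  ... | u , p = pad n ++ just a ∷ u , pad-∷ ≤-refl p

  split-leading : ∀ m {f n u w} → Padding (m + f) n u w →
    Σ (List (Maybe A)) λ u₂ → u ≡ pad m ++ u₂ × Padding f n u₂ w
  split-leading m (pad-[] h) with m≤n⇒∃[o]m+o≡n (m+n≤o⇒m≤o m h)
  ... | k , refl = pad k , pad-+ m k , pad-[] (+-cancelˡ-≤ m _ _ h)
  split-leading m (pad-∷ {a = a} {u = u} h p) with m≤n⇒∃[o]m+o≡n (m+n≤o⇒m≤o m h)
  ... | k , refl =
    pad k ++ just a ∷ u ,
    trans (cong (_++ just a ∷ u) (pad-+ m k)) (++-assoc (pad m) (pad k) (just a ∷ u)) ,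
    pad-∷ (+-cancelˡ-≤ m _ _ h) p

  split-after : ∀ a v₁ {v₂ f m n u} → Padding f (m + n) u (a ∷ v₁ ++ v₂) →
    Σ (List (Maybe A)) λ u₁ → Σ (List (Maybe A)) λ u₂ →
      u ≡ u₁ ++ u₂ × Padding f m u₁ (a ∷ v₁) × Padding n (m + n) u₂ v₂
  split-after a [] {m = m} (pad-∷ {k} h p) with split-leading m p
  ... | u₂ , refl , p₂ =
    pad k ++ just a ∷ pad m , u₂ , sym (++-assoc (pad k) (just a ∷ pad m) u₂) ,
    pad-∷ h (pad-[] ≤-refl) , p₂
  split-after a (b ∷ v₁) {m = m} {n} (pad-∷ {k} h p) with split-after b v₁ p
  ... | u₁ , u₂ , refl , p₁ , p₂ =
    pad k ++ just a ∷ u₁ , u₂ , sym (++-assoc (pad k) (just a ∷ u₁) u₂) ,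
    pad-∷ h (Padding-mono (m≤m+n m n) ≤-refl p₁) , p₂

  split-++ : ∀ w₁ {w₂ m n u} → Padding (m + n) (m + n) u (w₁ ++ w₂) →
    Σ (List (Maybe A)) λ u₁ → Σ (List (Maybe A)) λ u₂ →
      u ≡ u₁ ++ u₂ × Padding m m u₁ w₁ × Padding n n u₂ w₂
  split-++ [] {m = m} {n} p with split-leading m p
  ... | u₂ , eq , p₂ = pad m , u₂ , eq , pad-[] ≤-refl , Padding-mono ≤-refl (m≤n+m n m) p₂
  split-++ (a ∷ v) {m = m} {n} p with split-after a v p
  ... | u₁ , u₂ , eq , p₁ , p₂ =
    u₁ , u₂ , eq , Padding-mono (m≤m+n m n) ≤-refl p₁ , Padding-mono ≤-refl (m≤n+m n m) p₂

  Plus-Padding : ∀ {L : Lang A} {L′ : Lang (Maybe A)} n →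
    (∀ {v u} → L v → Padding n n u v → L′ u) →
    ∀ {w u} → NonEmptyPlus L w → Padding n (n + n) u w → Plus L′ u
  Plus-Padding n pad⇒ (one l) p = one (pad⇒ l (Padding-mono ≤-refl (m≤m+n n n) p))
  Plus-Padding n pad⇒ (more {a} {v₁} l q) p with split-after a v₁ p
  ... | u₁ , u₂ , refl , p₁ , p₂ = more (pad⇒ l p₁) (Plus-Padding n pad⇒ q p₂)

  Padding-∷ʳ : ∀ {f n v x k} {a : A} → Padding f n v x → n ≤ k →
    Padding f n (v ++ just a ∷ pad k) (x ∷ʳ a)
  Padding-∷ʳ (pad-[] h) n≤k = pad-∷ h (pad-[] n≤k)
  Padding-∷ʳ {k = k} {a} (pad-∷ {j} {b} {u} h p) n≤k =
    subst (λ z → Padding _ _ z _) (sym (++-assoc (pad j) (just b ∷ u) (just a ∷ pad k)))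
      (pad-∷ h (Padding-∷ʳ p n≤k))

  Padding-reverse : ∀ {n u w} → Padding n n u w → Padding n n (reverse u) (reverse w)
  Padding-reverse (pad-[] {k} h) = subst (λ z → Padding _ _ z []) (sym (reverse-pad k)) (pad-[] h)
  Padding-reverse {n} (pad-∷ {k} {a} {u} {w} h p) =
    subst₂ (Padding n n) reverse-u (sym (unfold-reverse a w)) (Padding-∷ʳ (Padding-reverse p) h)
    where
    open ≡-Reasoning
    reverse-u : reverse u ++ just a ∷ pad k ≡ reverse (pad k ++ just a ∷ u)
    reverse-u = sym (begin
      reverse (pad k ++ just a ∷ u)             ≡⟨ reverse-++ (pad k) (just a ∷ u) ⟩
      reverse (just a ∷ u) ++ reverse (pad k)   ≡⟨ cong₂ _++_ (unfold-reverse (just a) u) (reverse-pad k) ⟩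
      (reverse u ∷ʳ just a) ++ pad k            ≡⟨ ++-assoc (reverse u) (just a ∷ []) (pad k) ⟩
      reverse u ++ just a ∷ pad k               ∎)

padded : {X A : Set} → (X → Lang A) → X → Lang (Maybe A)
padded σ x u = u ≢ [] × σ x (catMaybes u)

module _ {X A : Set} (σ : X → Lang A) where

  oneFree-padded : (e : Expr X) → OneFree e → ∀ {w u} →
    ⟦ e ⟧ σ w → Padding (gap e) (gap e) u w → ⟦ e ⟧ (padded σ) u
  oneFree-padded (var x) _ s p = Padding-nonempty p , subst (σ x) (sym (Padding-catMaybes p)) s
  oneFree-padded (e ⊕ f) (oe , of) (inj₁ s) p =
    inj₁ (oneFree-padded e oe s (Padding-mono (m≤m+n _ _) (m≤m+n _ _) p))
  oneFree-padded (e ⊕ f) (oe , of) (inj₂ s) p =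
    inj₂ (oneFree-padded f of s (Padding-mono (m≤n+m _ _) (m≤n+m _ _) p))
  oneFree-padded (e ⊙ f) (oe , of) (w₁ , _ , refl , s , t) p with split-++ w₁ p
  ... | u₁ , u₂ , eq , p₁ , p₂ = u₁ , u₂ , eq , oneFree-padded e oe s p₁ , oneFree-padded f of t p₂
  oneFree-padded (e ⊓ f) (oe , of) (s , t) p =
    oneFree-padded e oe s (Padding-mono (m≤m+n _ _) (m≤m+n _ _) p) ,
    oneFree-padded f of t (Padding-mono (m≤n+m _ _) (m≤n+m _ _) p)
  oneFree-padded (e ⁺) oe s p with Plus-nonEmpty s
  ... | inj₁ (refl , s₁) = one (oneFree-padded e oe s₁ (Padding-mono (m≤m+n _ _) (m≤m+n _ _) p))
  ... | inj₂ q = Plus-Padding (gap e) (oneFree-padded e oe) q (Padding-mono (m≤m+n _ _) ≤-refl p)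
  oneFree-padded (conv e) oe s p = oneFree-padded e oe s (Padding-reverse p)

  PaddedView : Expr X → List (Maybe A) → Set
  PaddedView f u = (u ≡ [] × T (nullable f)) ⊎ (u ≢ [] × ⟦ oneFreePart f ⟧ σ (catMaybes u))

  nonempty-++ : {u v : List (Maybe A)} → u ≢ [] → u ++ v ≢ []
  nonempty-++ {u} {v} u≢[] eq = u≢[] (++-conicalˡ u v eq)

  when-⟦⟧ : {g : Expr X} {b : Bool} {w : List A} → T b → ⟦ g ⟧ σ w → ⟦ g when b ⟧ σ w
  when-⟦⟧ {b = true} _ s = s

  PaddedView-⊙ : ∀ e f {u₁ u₂} →
    PaddedView e u₁ → PaddedView f u₂ → PaddedView (e ⊙ f) (u₁ ++ u₂)
  PaddedView-⊙ _ _ (inj₁ (refl , νe)) (inj₁ (refl , νf)) = inj₁ (refl , Equivalence.from T-∧ (νe , νf))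
  PaddedView-⊙ _ _ (inj₁ (refl , νe)) (inj₂ (nz , t))    = inj₂ (nz , inj₁ (inj₂ (when-⟦⟧ νe t)))
  PaddedView-⊙ e f {u₁} (inj₂ (nz , s)) (inj₁ (refl , νf)) =
    subst (PaddedView (e ⊙ f)) (sym (++-identityʳ u₁)) (inj₂ (nz , inj₂ (when-⟦⟧ νf s)))
  PaddedView-⊙ _ _ {u₁} {u₂} (inj₂ (nz , s)) (inj₂ (_ , t)) =
    inj₂ (nonempty-++ nz , inj₁ (inj₁ (catMaybes u₁ , catMaybes u₂ , catMaybes-++ u₁ u₂ , s , t)))

  PaddedView-⁺ : ∀ e {u₁ u₂} →
    PaddedView e u₁ → PaddedView (e ⁺) u₂ → PaddedView (e ⁺) (u₁ ++ u₂)
  PaddedView-⁺ _ (inj₁ (refl , _)) v = v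
  PaddedView-⁺ e {u₁} (inj₂ (nz , s)) (inj₁ (refl , _)) =
    subst (PaddedView (e ⁺)) (sym (++-identityʳ u₁)) (inj₂ (nz , one s))
  PaddedView-⁺ e {u₁} {u₂} (inj₂ (nz , s)) (inj₂ (_ , t)) =
    inj₂ (nonempty-++ nz , subst (Plus (⟦ oneFreePart e ⟧ σ)) (sym (catMaybes-++ u₁ u₂)) (more s t))

  padded-view : (f : Expr X) → ∀ {u} → ⟦ f ⟧ (padded σ) u → PaddedView f u
  padded-view (var x) s = inj₂ s
  padded-view 𝟙 refl = inj₁ (refl , tt)
  padded-view (e ⊕ f) (inj₁ s) with padded-view e s
  ... | inj₁ (eq , ν) = inj₁ (eq , Equivalence.from T-∨ (inj₁ ν))
  ... | inj₂ (nz , t) = inj₂ (nz , inj₁ t)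
  padded-view (e ⊕ f) (inj₂ s) with padded-view f s
  ... | inj₁ (eq , ν) = inj₁ (eq , Equivalence.from T-∨ (inj₂ ν))
  ... | inj₂ (nz , t) = inj₂ (nz , inj₂ t)
  padded-view (e ⊙ f) (_ , _ , refl , s , t) = PaddedView-⊙ e f (padded-view e s) (padded-view f t)
  padded-view (e ⊓ f) (s , t) with padded-view e s | padded-view f t
  ... | inj₁ (eq , νe) | inj₁ (_ , νf) = inj₁ (eq , Equivalence.from T-∧ (νe , νf))
  ... | inj₁ (eq , _)  | inj₂ (nz , _) = ⊥-elim (nz eq)
  ... | inj₂ (nz , _)  | inj₁ (eq , _) = ⊥-elim (nz eq)
  ... | inj₂ (nz , s′) | inj₂ (_ , t′) = inj₂ (nz , s′ , t′)
  padded-view (e ⁺) s = view-plus s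
    where
    view-plus : ∀ {u} → Plus (⟦ e ⟧ (padded σ)) u → PaddedView (e ⁺) u
    view-plus (one s₁) with padded-view e s₁
    ... | inj₁ v = inj₁ v
    ... | inj₂ (nz , t) = inj₂ (nz , one t)
    view-plus (more s₁ s₂) = PaddedView-⁺ e (padded-view e s₁) (view-plus s₂)
  padded-view (conv e) {u} s with padded-view e s
  ... | inj₁ (eq , ν) = inj₁ (reverse-injective eq , ν)
  ... | inj₂ (nz , t) =
    inj₂ ((λ eq → nz (cong reverse eq)) , subst (⟦ oneFreePart e ⟧ σ) (catMaybes-reverse u) t)

  padded-oneFreePart : (f : Expr X) → ∀ {u} →
    ⟦ f ⟧ (padded σ) u → u ≢ [] → ⟦ oneFreePart f ⟧ σ (catMaybes u)
  padded-oneFreePart f s u≢[] with padded-view f s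
  ... | inj₁ (u≡[] , _) = ⊥-elim (u≢[] u≡[])
  ... | inj₂ (_ , t) = t

oneFreePart-maximal : {X : Set} (e f : Expr X) → OneFree e → e ≲ f → e ≲ oneFreePart f
oneFreePart-maximal e f oe e≲f A σ w s with uniformPadding (suc (gap e)) w
... | u , p = subst (⟦ oneFreePart f ⟧ σ) (Padding-catMaybes p)
  (padded-oneFreePart σ f (e≲f (Maybe A) (padded σ) u s′) (Padding-nonempty p))
  where
  s′ : ⟦ e ⟧ (padded σ) u
  s′ = oneFree-padded σ e oe s (Padding-mono (n≤1+n _) (n≤1+n _) p)

lemma20 : (X : Set) (f : Expr X) →
    Σ (Expr X) λ g → OneFree g × g ≦ f ×
      ((e : Expr X) → OneFree e → e ≲ f → e ≲ g)
lemma20 X f = oneFreePart f , oneFreePart-OneFree f , oneFreePart-≦ f , λ e oe → oneFreePart-maximal e f oe
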